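{- Let $\theta$ be a congruence of $\mathbf{L}_n$ with more than one equivalence class, let $k$ be its step, and let $r_1<\dots<r_m$ ($m\ge0$) be the increasing enumeration of the set $\{x : x\mathrel{\theta}x+1\}$. Then $\theta=\langle k;\bar r\rangle$ where $\bar r=\langle r_1,\dots,r_m\rangle$.
   Context: For an integer $n\ge 0$, the line $\mathbf{L}_n$ is the frame $\langle\{0,\dots,n\},R\rangle$ where $x\mathrel{R}y$ iff $|x-y|\le 1$. A congruence of $\mathbf{L}_n$ is an equivalence relation $\theta$ on $\{0,\dots,n\}$ such that whenever $x'\mathrel{\theta}x$ and $x\mathrel{R}y$ there is $y'$ with $x'\mathrel{R}y'$ and $y'\mathrel{\theta}y$. The quotient $\mathbf{L}_n/\theta$ has universe the set of $\theta$-classes, with $x/\theta$ related to $y/\theta$ iff $x'\mathrel{R}y'$ for some $x'\mathrel{\theta}x$, $y'\mathrel{\theta}y$; it is isomorphic to a line, and the step of $\theta$ is the number of $\theta$-classes minus one. For $k\ge1$ and a strictly increasing sequence $\bar r$ of non-negative integers, $\Delta_{\bar r}(x)=|\{i: r_i<x\}|$ and $x\,\langle k;\bar r\rangle\,y$ iff $x-\Delta_{\bar r}(x)\equiv \pm(y-\Delta_{\bar r}(y))\pmod{2k}$ (relation on $\{0,\dots,n\}$). -}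

module Defs where

open import Data.Nat using (ℕ; suc; _<_; _≤_; _+_; _*_; _∸_; ∣_-_∣; _<?_)
open import Data.Nat.Divisibility using (_∣_)
open import Data.Fin using (Fin; toℕ)
open import Data.List using (List; length; filter)
open import Data.List.Membership.Propositional using (_∈_)
open import Data.List.Relation.Unary.Linked using (Linked)
open import Data.Product using (Σ; ∃; _×_)
open import Data.Sum using (_⊎_)
open import Function.Bundles using (_⇔_)
open import Relation.Binary.PropositionalEquality using (_≡_)
open import Relation.Binary.Structures using (IsEquivalence)
open import Level using (0ℓ)

Pt : ℕ → Set
Pt n = Fin (suc n)

LR : ∀ {n} → Pt n → Pt n → Set
LR x y = ∣ toℕ x - toℕ y ∣ ≤ 1

PRel : ℕ → Set₁
PRel n = Pt n → Pt n → Set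

record IsCongruence {n : ℕ} (θ : PRel n) : Set where
  field
    isEquivalence : IsEquivalence θ
    zigzag : ∀ x x' y → θ x' x → LR x y → Σ (Pt n) λ y' → LR x' y' × θ y' y

-- θ has exactly c equivalence classes: there is a surjection f onto Fin c
-- whose kernel is θ (equivalently, a bijection between the set of θ-classes
-- and Fin c).
HasClasses : ∀ {n} → PRel n → ℕ → Set
HasClasses {n} θ c =
  Σ (Pt n → Fin c) λ f →
    (∀ (j : Fin c) → Σ (Pt n) λ x → f x ≡ j) ×
    (∀ x y → θ x y ⇔ (f x ≡ f y))

Δ : List ℕ → ℕ → ℕ
Δ rs x = length (filter (_<? x) rs)

_≡±_mod_ : ℕ → ℕ → ℕ → Set
a ≡± b mod m = (m ∣ ∣ a - b ∣) ⊎ (m ∣ (a + b))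

-- x ⟨k; r⟩ y iff x - Δ(x) ≡ ±(y - Δ(y)) (mod 2k)
-- (x - Δ(x) ≥ 0 always, since the r_i are distinct non-negative integers,
--  so truncated subtraction is exact here.)
⟨_⨾_⟩ : ∀ {n} → ℕ → List ℕ → PRel n
⟨ k ⨾ rs ⟩ x y =
  (toℕ x ∸ Δ rs (toℕ x)) ≡± (toℕ y ∸ Δ rs (toℕ y)) mod (2 * k)

Enumerates : ∀ {n} → PRel n → List ℕ → Set
Enumerates {n} θ rs =
  Linked _<_ rs ×
  (∀ (x : Pt n) (y : Pt n) → toℕ y ≡ suc (toℕ x) → (θ x y ⇔ (toℕ x ∈ rs))) ×
  (∀ r → r ∈ rs → r < n)

module Submission where

-- Let h x = x − Δ_r̄(x) be the reduced coordinate: h 0 = 0, and h grows by one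
-- along each step x → x+1 that leaves the θ-class of x, staying put otherwise.
-- Let wave b ∈ {0..k} be the triangle wave of period 2k (the distance from b to
-- the nearest multiple of 2k), so that wave a = wave b iff a ≡ ±b (mod 2k).
-- The theorem says that x θ y iff wave (h x) = wave (h y): running through
-- 0..n, the classes sweep the quotient line L_k back and forth.  This is proved
-- by induction on x for any labelling of L_n by k+1 labels that is onto and
-- satisfies the zigzag condition (module LabelledLine); the decisive step uses
-- the zigzag condition to show that the sweep turns only at the ends 0 and k,
-- and a counting argument with the pigeonhole principle to show that new
-- labels appear exactly while h x < k.

open import Defs
open import Data.Nat using (ℕ; suc; _≥_)
open import Data.List using (List)
open import Function.Bundles using (_⇔_)

open import Data.Nat
  using (zero; _+_; _*_; _∸_; _⊓_; _≤_; _<_; z≤n; z<s; s≤s; s≤s⁻¹; ∣_-_∣; _≟_; _≤?_; _<?_; NonZero)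
open import Data.Nat.Properties
open import Data.Nat.DivMod using (_%_; _/_; m≡m%n+[m/n]*n; m%n<n; m%n≤m; [m+kn]%n≡m%n; n%n≡0; m<n⇒m%n≡m; %-distribˡ-+)
open import Data.Nat.Divisibility using (_∣_; divides; m%n≡0⇒n∣m; n∣m⇒m%n≡0)
open import Data.Nat.Solver using (module +-*-Solver)
open import Data.Fin using (Fin; toℕ; fromℕ<) renaming (zero to fzero; suc to fsuc; _≟_ to _≟ᶠ_)
open import Data.Fin.Properties using (toℕ-fromℕ<; toℕ-injective; toℕ<n; injective⇒≤)
open import Data.List using ([]; _∷_; length; filter)
open import Data.List.Properties using (filter-accept; filter-reject)
open import Data.List.Membership.Propositional using (_∈_; _∉_)
open import Data.List.Membership.DecPropositional _≟_ using (_∈?_)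
open import Data.List.Relation.Unary.Any using (here; there)
import Data.List.Relation.Unary.All as All
open import Data.List.Relation.Unary.AllPairs using (AllPairs; _∷_)
open import Data.List.Relation.Unary.Linked.Properties using (Linked⇒AllPairs)
open import Data.Sum using (_⊎_; inj₁; inj₂)
open import Data.Product using (Σ; _×_; _,_; proj₁; proj₂)
open import Data.Empty using (⊥; ⊥-elim)
open import Relation.Nullary using (¬_; yes; no)
open import Relation.Nullary.Decidable using (decidable-stable)
open import Relation.Binary.PropositionalEquality
open import Function.Base using (_∘_)
open import Function.Bundles using (Equivalence; mk⇔)
open import Function.Properties.Equivalence using (⇔-setoid)
open import Level using (0ℓ)

module _ (m : ℕ) .{{_ : NonZero m}} where

  %-eq⇒∣-dist : ∀ a b → a % m ≡ b % m → m ∣ ∣ a - b ∣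
  %-eq⇒∣-dist a b e = divides ∣ a / m - b / m ∣ (begin
      ∣ a - b ∣
        ≡⟨ cong₂ ∣_-_∣ (m≡m%n+[m/n]*n a m) (trans (m≡m%n+[m/n]*n b m) (cong (_+ (b / m) * m) (sym e))) ⟩
      ∣ a % m + (a / m) * m - a % m + (b / m) * m ∣ ≡⟨ ∣m+n-m+o∣≡∣n-o∣ (a % m) _ _ ⟩
      ∣ (a / m) * m - (b / m) * m ∣                 ≡⟨ *-distribʳ-∣-∣ m (a / m) (b / m) ⟨
      ∣ a / m - b / m ∣ * m                         ∎)
    where open ≡-Reasoning

  ∣-diff⇒%-eq : ∀ a b → a ≤ b → m ∣ b ∸ a → a % m ≡ b % m
  ∣-diff⇒%-eq a b a≤b (divides q e) = sym (begin
      b % m                ≡⟨ cong (_% m) (m+[n∸m]≡n a≤b) ⟨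
      (a + (b ∸ a)) % m    ≡⟨ cong (λ t → (a + t) % m) e ⟩
      (a + q * m) % m      ≡⟨ [m+kn]%n≡m%n a q m ⟩
      a % m                ∎)
    where open ≡-Reasoning

  ∣-dist⇒%-eq : ∀ a b → m ∣ ∣ a - b ∣ → a % m ≡ b % m
  ∣-dist⇒%-eq a b d with ≤-total a b
  ... | inj₁ a≤b = ∣-diff⇒%-eq a b a≤b (subst (m ∣_) (m≤n⇒∣m-n∣≡n∸m a≤b) d)
  ... | inj₂ b≤a = sym (∣-diff⇒%-eq b a b≤a (subst (m ∣_) (trans (∣-∣-comm a b) (m≤n⇒∣m-n∣≡n∸m b≤a)) d))

  %-sum⇒∣-sum : ∀ a b → a % m + b % m ≡ m → m ∣ a + b
  %-sum⇒∣-sum a b e = divides (suc (a / m + b / m)) (begin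
      a + b                                        ≡⟨ cong₂ _+_ (m≡m%n+[m/n]*n a m) (m≡m%n+[m/n]*n b m) ⟩
      (a % m + (a / m) * m) + (b % m + (b / m) * m) ≡⟨ regroup (a % m) (a / m) (b % m) (b / m) m ⟩
      (a % m + b % m) + (a / m + b / m) * m        ≡⟨ cong (_+ (a / m + b / m) * m) e ⟩
      suc (a / m + b / m) * m                      ∎)
    where
    open ≡-Reasoning
    open +-*-Solver
    regroup : ∀ ra qa rb qb d → (ra + qa * d) + (rb + qb * d) ≡ (ra + rb) + (qa + qb) * d
    regroup = solve 5 (λ ra qa rb qb d → (ra :+ qa :* d) :+ (rb :+ qb :* d) := (ra :+ rb) :+ (qa :+ qb) :* d) refl

  ∣-sum⇒%-sum : ∀ a b → m ∣ a + b → a % m + b % m ≡ m ⊎ (a % m ≡ 0 × b % m ≡ 0)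
  ∣-sum⇒%-sum a b d with m%n≡0⇒n∣m (a % m + b % m) m (trans (sym (%-distribˡ-+ a b m)) (n∣m⇒m%n≡0 (a + b) m d))
  ... | divides zero e = inj₂ (m+n≡0⇒m≡0 (a % m) e , m+n≡0⇒n≡0 (a % m) e)
  ... | divides (suc zero) e = inj₁ (trans e (+-identityʳ m))
  ... | divides (suc (suc q)) e = ⊥-elim (<-irrefl e (<-≤-trans (+-mono-< (m%n<n a m) (m%n<n b m))
          (+-monoʳ-≤ m (m≤m+n m (q * m)))))

  suc-%≡suc-%-% : ∀ b → suc b % m ≡ suc (b % m) % m
  suc-%≡suc-%-% b = trans (cong (λ t → suc t % m) (m≡m%n+[m/n]*n b m)) ([m+kn]%n≡m%n (suc (b % m)) (b / m) m)

  %-suc : ∀ b → (suc (b % m) < m × suc b % m ≡ suc (b % m)) ⊎ (suc (b % m) ≡ m × suc b % m ≡ 0)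
  %-suc b with suc (b % m) <? m
  ... | yes lt = inj₁ (lt , trans (suc-%≡suc-%-% b) (m<n⇒m%n≡m lt))
  ... | no ¬lt = inj₂ (wrap , trans (suc-%≡suc-%-% b) (trans (cong (_% m) wrap) (n%n≡0 m)))
    where
    wrap : suc (b % m) ≡ m
    wrap = ≤-antisym (m%n<n b m) (≮⇒≥ ¬lt)

m≢2+m : ∀ {m} → m ≢ suc (suc m)
m≢2+m ()

≤-suc-cases : ∀ {y x} → y ≤ suc x → y ≤ x ⊎ y ≡ suc x
≤-suc-cases y≤1+x with m≤n⇒m<n∨m≡n y≤1+x
... | inj₁ y<1+x = inj₁ (s≤s⁻¹ y<1+x)
... | inj₂ y≡1+x = inj₂ y≡1+x

∸-pred-suc : ∀ a b → b < a → a ∸ b ≡ suc (a ∸ suc b)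
∸-pred-suc (suc a) zero    _         = refl
∸-pred-suc (suc a) (suc b) (s≤s b<a) = ∸-pred-suc a b b<a

Adjacent : ℕ → ℕ → Set
Adjacent u v = suc u ≡ v ⊎ u ≡ suc v

Near : ℕ → ℕ → Set
Near u v = u ≡ v ⊎ Adjacent u v

near-sym : ∀ {u v} → Near u v → Near v u
near-sym (inj₁ e)        = inj₁ (sym e)
near-sym (inj₂ (inj₁ e)) = inj₂ (inj₂ (sym e))
near-sym (inj₂ (inj₂ e)) = inj₂ (inj₁ (sym e))

adjacent⇒≢ : ∀ {u v} → Adjacent u v → u ≢ v
adjacent⇒≢ (inj₁ refl) ()
adjacent⇒≢ (inj₂ refl) ()

near-≢⇒adjacent : ∀ {u v} → Near u v → u ≢ v → Adjacent u v
near-≢⇒adjacent (inj₁ e)   u≢v = ⊥-elim (u≢v e)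
near-≢⇒adjacent (inj₂ adj) _   = adj

near⇒≤suc : ∀ {u v} → Near u v → v ≤ suc u
near⇒≤suc (inj₁ refl)        = n≤1+n _
near⇒≤suc (inj₂ (inj₁ refl)) = ≤-refl
near⇒≤suc (inj₂ (inj₂ refl)) = ≤-trans (n≤1+n _) (n≤1+n _)

∣n-1+n∣≡1 : ∀ n → ∣ n - suc n ∣ ≡ 1
∣n-1+n∣≡1 n = trans (m≤n⇒∣m-n∣≡n∸m (n≤1+n n)) (m+n∸n≡m 1 n)

near⇔dist≤1 : ∀ u v → Near u v ⇔ (∣ u - v ∣ ≤ 1)
near⇔dist≤1 u v = mk⇔ (to u v) (from u v)
  where
  to : ∀ u v → Near u v → ∣ u - v ∣ ≤ 1
  to u .u       (inj₁ refl)        = ≤-trans (≤-reflexive (m≡n⇒∣m-n∣≡0 {u} refl)) z≤n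
  to u .(suc u) (inj₂ (inj₁ refl)) = ≤-reflexive (∣n-1+n∣≡1 u)
  to .(suc v) v (inj₂ (inj₂ refl)) = ≤-reflexive (trans (∣-∣-comm (suc v) v) (∣n-1+n∣≡1 v))

  from : ∀ u v → ∣ u - v ∣ ≤ 1 → Near u v
  from zero          zero          _ = inj₁ refl
  from zero          (suc zero)    _ = inj₂ (inj₁ refl)
  from (suc zero)    zero          _ = inj₂ (inj₂ refl)
  from zero          (suc (suc v)) (s≤s ())
  from (suc (suc u)) zero          (s≤s ())
  from (suc u)       (suc v)       d with from u v d
  ... | inj₁ e        = inj₁ (cong suc e)
  ... | inj₂ (inj₁ e) = inj₂ (inj₁ (cong suc e))
  ... | inj₂ (inj₂ e) = inj₂ (inj₂ (cong suc e))

opposite-sides : ∀ {a b c} → Adjacent a b → Adjacent a c → b ≢ c →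
                 (suc a ≡ b × a ≡ suc c) ⊎ (a ≡ suc b × suc a ≡ c)
opposite-sides (inj₁ ab) (inj₁ ac) b≢c = ⊥-elim (b≢c (trans (sym ab) ac))
opposite-sides (inj₁ ab) (inj₂ ac) _   = inj₁ (ab , ac)
opposite-sides (inj₂ ab) (inj₁ ac) _   = inj₂ (ab , ac)
opposite-sides (inj₂ ab) (inj₂ ac) b≢c = ⊥-elim (b≢c (suc-injective (trans (sym ab) ac)))

-- The triangle wave of period 2k and amplitude k ≥ 1 (written k = 1 + k-1):
-- the projection of the reduced coordinate onto the quotient line L_k.
module Wave (k-1 : ℕ) where

  k : ℕ
  k = suc k-1

  period : ℕ
  period = 2 * k

  period≡k+k : period ≡ k + k
  period≡k+k = cong (k +_) (+-identityʳ k)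

  period∸k≡k : period ∸ k ≡ k
  period∸k≡k = trans (cong (_∸ k) period≡k+k) (m+n∸m≡n k k)

  k<period : k < period
  k<period = subst (k <_) (sym period≡k+k) (m<m+n k {k} z<s)

  fold : ℕ → ℕ
  fold c = c ⊓ (period ∸ c)

  wave : ℕ → ℕ
  wave b = fold (b % period)

  period∸-≤k : ∀ {c} → k ≤ c → period ∸ c ≤ k
  period∸-≤k {c} k≤c = subst (period ∸ c ≤_) period∸k≡k (∸-monoʳ-≤ period k≤c)

  fold-low : ∀ {c} → c ≤ k → fold c ≡ c
  fold-low {c} c≤k = m≤n⇒m⊓n≡m (≤-trans c≤k (subst (_≤ period ∸ c) period∸k≡k (∸-monoʳ-≤ period c≤k)))

  fold-high : ∀ {c} → k ≤ c → fold c ≡ period ∸ c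
  fold-high k≤c = m≥n⇒m⊓n≡n (≤-trans (period∸-≤k k≤c) k≤c)

  fold≤k : ∀ c → fold c ≤ k
  fold≤k c with c ≤? k
  ... | yes c≤k = ≤-trans (m⊓n≤m c _) c≤k
  ... | no c≰k  = subst (_≤ k) (sym (fold-high k≤c)) (period∸-≤k k≤c)
    where k≤c = <⇒≤ (≰⇒> c≰k)

  fold-mirror : ∀ {c} → c ≤ period → fold (period ∸ c) ≡ fold c
  fold-mirror {c} c≤p = trans (cong ((period ∸ c) ⊓_) (m∸[m∸n]≡n c≤p)) (⊓-comm (period ∸ c) c)

  fold-injective : ∀ {c d} → c ≤ period → d ≤ period → fold c ≡ fold d → c ≡ d ⊎ c + d ≡ period
  fold-injective {c} {d} c≤p d≤p e with ⊓-sel c (period ∸ c) | ⊓-sel d (period ∸ d)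
  ... | inj₁ fc | inj₁ fd = inj₁ (trans (sym fc) (trans e fd))
  ... | inj₁ fc | inj₂ fd = inj₂ (trans (cong (_+ d) (trans (sym fc) (trans e fd))) (m∸n+n≡m d≤p))
  ... | inj₂ fc | inj₁ fd = inj₂ (trans (cong (c +_) (sym (trans (sym fc) (trans e fd)))) (m+[n∸m]≡n c≤p))
  ... | inj₂ fc | inj₂ fd = inj₁ (∸-cancelˡ-≡ c≤p d≤p (trans (sym fc) (trans e fd)))

  wave≤ : ∀ b → wave b ≤ b
  wave≤ b = ≤-trans (m⊓n≤m (b % period) _) (m%n≤m b period)

  wave≤k : ∀ b → wave b ≤ k
  wave≤k b = fold≤k (b % period)

  wave-low : ∀ {b} → b ≤ k → wave b ≡ b
  wave-low {b} b≤k = trans (cong fold (m<n⇒m%n≡m (≤-<-trans b≤k k<period))) (fold-low b≤k)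

  wave-rise : ∀ b → b % period < k → wave (suc b) ≡ suc (wave b)
  wave-rise b r<k with %-suc period b
  ... | inj₁ (_ , e) = trans (cong fold e) (trans (fold-low r<k) (cong suc (sym (fold-low (<⇒≤ r<k)))))
  ... | inj₂ (e , _) = ⊥-elim (<-irrefl e (≤-<-trans r<k k<period))

  wave-fall : ∀ b → k ≤ b % period → wave b ≡ suc (wave (suc b))
  wave-fall b k≤r with %-suc period b
  ... | inj₁ (lt , e) = begin
      fold r                       ≡⟨ fold-high k≤r ⟩
      period ∸ r                   ≡⟨ ∸-pred-suc period r (<⇒≤ lt) ⟩
      suc (period ∸ suc r)         ≡⟨ cong suc (fold-high (m≤n⇒m≤1+n k≤r)) ⟨
      suc (fold (suc r))           ≡⟨ cong (λ t → suc (fold t)) e ⟨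
      suc (wave (suc b))           ∎
    where
    open ≡-Reasoning
    r = b % period
  ... | inj₂ (wrap , e) = begin
      fold r                       ≡⟨ fold-high k≤r ⟩
      period ∸ r                   ≡⟨ cong (_∸ r) wrap ⟨
      suc r ∸ r                    ≡⟨ +-∸-assoc 1 (≤-refl {r}) ⟩
      suc (r ∸ r)                  ≡⟨ cong suc (n∸n≡0 r) ⟩
      1                            ≡⟨ cong (λ t → suc (fold t)) e ⟨
      suc (wave (suc b))           ∎
    where
    open ≡-Reasoning
    r = b % period

  wave-step : ∀ b → Adjacent (wave b) (wave (suc b))
  wave-step b with b % period <? k
  ... | yes r<k = inj₁ (sym (wave-rise b r<k))
  ... | no r≮k  = inj₂ (wave-fall b (≮⇒≥ r≮k))

  wave-near : ∀ {a b} → Near a b → Near (wave a) (wave b)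
  wave-near (inj₁ refl)        = inj₁ refl
  wave-near (inj₂ (inj₁ refl)) = inj₂ (wave-step _)
  wave-near (inj₂ (inj₂ refl)) with wave-step _
  ... | inj₁ up   = inj₂ (inj₂ (sym up))
  ... | inj₂ down = inj₂ (inj₁ (sym down))

  wave-peak : ∀ b → b % period < k → k ≤ suc b % period → wave (suc b) ≡ k
  wave-peak b r<k k≤r′ with %-suc period b
  ... | inj₁ (_ , e) = trans (cong fold e) (trans (cong fold r+1≡k) (fold-low ≤-refl))
    where
    r+1≡k : suc (b % period) ≡ k
    r+1≡k = ≤-antisym r<k (subst (k ≤_) e k≤r′)
  ... | inj₂ (wrap , _) = ⊥-elim (<-irrefl wrap (≤-<-trans r<k k<period))

  wave-trough : ∀ b → k ≤ b % period → suc b % period < k → wave (suc b) ≡ 0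
  wave-trough b k≤r r′<k with %-suc period b
  ... | inj₁ (_ , e) = ⊥-elim (<-irrefl refl (<-≤-trans (subst (_< k) e r′<k) (m≤n⇒m≤1+n k≤r)))
  ... | inj₂ (_ , e) = cong fold e

  wave-turn : ∀ b → wave b ≡ wave (suc (suc b)) → wave (suc b) ≡ 0 ⊎ wave (suc b) ≡ k
  wave-turn b e with b % period <? k | suc b % period <? k
  ... | yes r<k | yes r′<k = ⊥-elim (m≢2+m (trans e (trans (wave-rise (suc b) r′<k) (cong suc (wave-rise b r<k)))))
  ... | no r≮k  | no r′≮k  = ⊥-elim (m≢2+m (trans (sym e) (trans (wave-fall b (≮⇒≥ r≮k)) (cong suc (wave-fall (suc b) (≮⇒≥ r′≮k))))))
  ... | yes r<k | no r′≮k  = inj₂ (wave-peak b r<k (≮⇒≥ r′≮k))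
  ... | no r≮k  | yes r′<k = inj₁ (wave-trough b (≮⇒≥ r≮k) r′<k)

  wave-≡⇔≡± : ∀ a b → (wave a ≡ wave b) ⇔ (a ≡± b mod period)
  wave-≡⇔≡± a b = mk⇔ to from
    where
    ra = a % period
    rb = b % period
    ra≤p = <⇒≤ (m%n<n a period)
    rb≤p = <⇒≤ (m%n<n b period)

    to : wave a ≡ wave b → a ≡± b mod period
    to e with fold-injective ra≤p rb≤p e
    ... | inj₁ same   = inj₁ (%-eq⇒∣-dist period a b same)
    ... | inj₂ mirror = inj₂ (%-sum⇒∣-sum period a b mirror)

    from : a ≡± b mod period → wave a ≡ wave b
    from (inj₁ d) = cong fold (∣-dist⇒%-eq period a b d)
    from (inj₂ d) with ∣-sum⇒%-sum period a b d
    ... | inj₂ (ra≡0 , rb≡0) = cong fold (trans ra≡0 (sym rb≡0))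
    ... | inj₁ mirror = begin
        fold ra                ≡⟨ fold-mirror ra≤p ⟨
        fold (period ∸ ra)     ≡⟨ cong (λ t → fold (t ∸ ra)) mirror ⟨
        fold (ra + rb ∸ ra)    ≡⟨ cong fold (m+n∸m≡n ra rb) ⟩
        fold rb                ∎
      where open ≡-Reasoning

Δ-∷-below : ∀ {x r} rs → r < x → Δ (r ∷ rs) x ≡ suc (Δ rs x)
Δ-∷-below {x} rs r<x = cong length (filter-accept (_<? x) r<x)

Δ-∷-above : ∀ {x r} rs → ¬ r < x → Δ (r ∷ rs) x ≡ Δ rs x
Δ-∷-above {x} rs r≮x = cong length (filter-reject (_<? x) r≮x)

Δ-zero : ∀ rs → Δ rs 0 ≡ 0
Δ-zero []       = refl
Δ-zero (r ∷ rs) = trans (Δ-∷-above {0} {r} rs λ ()) (Δ-zero rs)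

Δ-suc-∉ : ∀ rs x → x ∉ rs → Δ rs (suc x) ≡ Δ rs x
Δ-suc-∉ []       x _   = refl
Δ-suc-∉ (r ∷ rs) x x∉ with r <? suc x | r <? x
... | yes r≤x | yes r<x =
  trans (Δ-∷-below rs r≤x) (trans (cong suc (Δ-suc-∉ rs x (x∉ ∘ there))) (sym (Δ-∷-below rs r<x)))
... | no r≰x  | no r≮x  =
  trans (Δ-∷-above rs r≰x) (trans (Δ-suc-∉ rs x (x∉ ∘ there)) (sym (Δ-∷-above rs r≮x)))
... | yes r≤x | no r≮x  = ⊥-elim (x∉ (here (≤-antisym (≮⇒≥ r≮x) (s≤s⁻¹ r≤x))))
... | no r≰x  | yes r<x = ⊥-elim (r≰x (m≤n⇒m≤1+n r<x))

Δ-suc-∈ : ∀ rs x → AllPairs _<_ rs → x ∈ rs → Δ rs (suc x) ≡ suc (Δ rs x)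
Δ-suc-∈ (r ∷ rs) .r (r<rs ∷ _) (here refl) = begin
    Δ (r ∷ rs) (suc r)      ≡⟨ Δ-∷-below rs ≤-refl ⟩
    suc (Δ rs (suc r))      ≡⟨ cong suc (Δ-suc-∉ rs r (λ r∈ → <-irrefl refl (All.lookup r<rs r∈))) ⟩
    suc (Δ rs r)            ≡⟨ cong suc (Δ-∷-above rs (<-irrefl refl)) ⟨
    suc (Δ (r ∷ rs) r)      ∎
  where open ≡-Reasoning
Δ-suc-∈ (r ∷ rs) x (r<rs ∷ inc) (there x∈) = begin
    Δ (r ∷ rs) (suc x)      ≡⟨ Δ-∷-below rs (m≤n⇒m≤1+n r<x) ⟩
    suc (Δ rs (suc x))      ≡⟨ cong suc (Δ-suc-∈ rs x inc x∈) ⟩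
    suc (suc (Δ rs x))      ≡⟨ cong suc (Δ-∷-below rs r<x) ⟨
    suc (Δ (r ∷ rs) x)      ∎
  where
  open ≡-Reasoning
  r<x = All.lookup r<rs x∈

-- A strictly increasing rs has at most x elements below x, so x ∸ Δ rs x is exact.
Δ≤ : ∀ rs x → AllPairs _<_ rs → Δ rs x ≤ x
Δ≤ rs zero    _   = subst (_≤ 0) (sym (Δ-zero rs)) z≤n
Δ≤ rs (suc x) inc with x ∈? rs
... | yes x∈ = subst (_≤ suc x) (sym (Δ-suc-∈ rs x inc x∈)) (s≤s (Δ≤ rs x inc))
... | no x∉  = subst (_≤ suc x) (sym (Δ-suc-∉ rs x x∉)) (m≤n⇒m≤1+n (Δ≤ rs x inc))

reduced : List ℕ → ℕ → ℕ
reduced rs x = x ∸ Δ rs x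

reduced-zero : ∀ rs → reduced rs 0 ≡ 0
reduced-zero rs = 0∸n≡0 (Δ rs 0)

reduced-∈ : ∀ rs x → AllPairs _<_ rs → x ∈ rs → reduced rs (suc x) ≡ reduced rs x
reduced-∈ rs x inc x∈ = cong (suc x ∸_) (Δ-suc-∈ rs x inc x∈)

reduced-∉ : ∀ rs x → AllPairs _<_ rs → x ∉ rs → reduced rs (suc x) ≡ suc (reduced rs x)
reduced-∉ rs x inc x∉ = trans (cong (suc x ∸_) (Δ-suc-∉ rs x x∉)) (+-∸-assoc 1 (Δ≤ rs x inc))

-- The points 0..n of the line carry labels from a set of k+1 elements
-- (later: the θ-classes); every label is used, and the labelling satisfies the
-- zigzag condition of a congruence.

module LabelledLine
  (n k-1 : ℕ) (label : ℕ → Fin (suc (suc k-1)))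
  (zigzag : ∀ a a′ b → a ≤ n → a′ ≤ n → b ≤ n → label a′ ≡ label a → Near a b →
            Σ ℕ λ b′ → b′ ≤ n × Near a′ b′ × label b′ ≡ label b)
  (onto : ∀ j → Σ ℕ λ m → m ≤ n × label m ≡ j)
  (h : ℕ → ℕ) (h-zero : h 0 ≡ 0)
  (h-stay : ∀ x → suc x ≤ n → label x ≡ label (suc x) → h (suc x) ≡ h x)
  (h-move : ∀ x → suc x ≤ n → label x ≢ label (suc x) → h (suc x) ≡ suc (h x))
  where

  open Wave k-1

  h-step : ∀ x → suc x ≤ n → h (suc x) ≡ h x ⊎ h (suc x) ≡ suc (h x)
  h-step x sx≤n with label x ≟ᶠ label (suc x)
  ... | yes same = inj₁ (h-stay x sx≤n same)
  ... | no moved = inj₂ (h-move x sx≤n moved)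

  h-mono : ∀ {y} x → y ≤ x → x ≤ n → h y ≤ h x
  h-mono zero    z≤n  _     = ≤-refl
  h-mono (suc x) y≤1+x sx≤n with ≤-suc-cases y≤1+x | h-step x sx≤n
  ... | inj₂ refl | _         = ≤-refl
  ... | inj₁ y≤x  | inj₁ stay = ≤-trans (h-mono x y≤x (≤-trans (n≤1+n x) sx≤n)) (≤-reflexive (sym stay))
  ... | inj₁ y≤x  | inj₂ move = ≤-trans (m≤n⇒m≤1+n (h-mono x y≤x (≤-trans (n≤1+n x) sx≤n))) (≤-reflexive (sym move))

  h-near : ∀ {u v} → Near u v → u ≤ n → v ≤ n → Near (h u) (h v)
  h-near (inj₁ refl)                  _    _    = inj₁ refl
  h-near {u} (inj₂ (inj₁ refl)) _ sx≤n with h-step u sx≤n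
  ... | inj₁ stay = inj₁ (sym stay)
  ... | inj₂ move = inj₂ (inj₁ (sym move))
  h-near {v = v} (inj₂ (inj₂ refl)) sx≤n _ with h-step v sx≤n
  ... | inj₁ stay = inj₁ stay
  ... | inj₂ move = inj₂ (inj₂ move)

  h-crossing : ∀ x → x ≤ n → ∀ d → suc d ≤ h x → Σ ℕ λ t → suc t ≤ x × h t ≡ d × h (suc t) ≡ suc d
  h-crossing zero    _    d d<h = ⊥-elim (1+n≰n (≤-trans (subst (suc d ≤_) h-zero d<h) z≤n))
  h-crossing (suc x) sx≤n d d<h with suc d ≤? h x
  ... | yes d<hx = let t , t<x , ht , hst = h-crossing x (≤-trans (n≤1+n x) sx≤n) d d<hx
                   in t , m≤n⇒m≤1+n t<x , ht , hst
  ... | no d≮hx = x , ≤-refl , hx≡d , ≤-antisym (subst (λ v → h (suc x) ≤ suc v) hx≡d h-up) d<h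
    where
    h-up : h (suc x) ≤ suc (h x)
    h-up with h-step x sx≤n
    ... | inj₁ stay = ≤-trans (≤-reflexive stay) (n≤1+n _)
    ... | inj₂ move = ≤-reflexive move
    hx≡d : h x ≡ d
    hx≡d = ≤-antisym (s≤s⁻¹ (≰⇒> d≮hx)) (s≤s⁻¹ (≤-trans d<h h-up))

  place : ℕ → ℕ
  place y = wave (h y)

  place-near : ∀ {u v} → Near u v → u ≤ n → v ≤ n → Near (place u) (place v)
  place-near uv u≤n v≤n = wave-near (h-near uv u≤n v≤n)

  placed-below : ∀ x → x ≤ n → k ≤ h x → ∀ v → v ≤ k → Σ ℕ λ y → y ≤ x × place y ≡ v
  placed-below x x≤n k≤h zero    _   = 0 , z≤n , cong wave h-zero
  placed-below x x≤n k≤h (suc d) v≤k =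
    let t , t<x , _ , hst = h-crossing x x≤n d (≤-trans v≤k k≤h)
    in suc t , t<x , trans (cong wave hst) (wave-low v≤k)

  place-crossing : ∀ x → x ≤ n → k ≤ h x → ∀ d → suc d ≤ k →
                   Σ ℕ λ t → suc t ≤ x × place t ≡ d × place (suc t) ≡ suc d
  place-crossing x x≤n k≤h d d<k =
    let t , t<x , ht , hst = h-crossing x x≤n d (≤-trans d<k k≤h)
    in t , t<x , trans (cong wave ht) (wave-low (<⇒≤ d<k)) , trans (cong wave hst) (wave-low d<k)

  Agrees : ℕ → Set
  Agrees x = ∀ y y′ → y ≤ x → y′ ≤ x → (label y ≡ label y′) ⇔ (place y ≡ place y′)

  Seen : ℕ → ℕ → Set
  Seen x s = Σ ℕ λ y → y ≤ x × label s ≡ label y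

  seen? : ∀ x s → Seen x s ⊎ (∀ y → y ≤ x → label s ≢ label y)
  seen? zero s with label s ≟ᶠ label 0
  ... | yes same = inj₁ (0 , z≤n , same)
  ... | no diff  = inj₂ λ { .0 z≤n → diff }
  seen? (suc x) s with label s ≟ᶠ label (suc x) | seen? x s
  ... | yes same | _                     = inj₁ (suc x , ≤-refl , same)
  ... | no _     | inj₁ (y , y≤x , same) = inj₁ (y , m≤n⇒m≤1+n y≤x , same)
  ... | no diff  | inj₂ unseen           = inj₂ unseen′
    where
    unseen′ : ∀ y → y ≤ suc x → label s ≢ label y
    unseen′ y y≤1+x with ≤-suc-cases y≤1+x
    ... | inj₁ y≤x  = unseen y y≤x
    ... | inj₂ refl = diff

  -- If the point x+1 shows no new label, no later point does: by the zigzag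
  -- condition a label next to a seen one is next to a point 0..x+1.
  seen-closed : ∀ x → x ≤ n → (∀ w → w ≤ suc x → Seen x w) → ∀ m → m ≤ n → Seen x m
  seen-closed x x≤n seen zero    _    = seen 0 z≤n
  seen-closed x x≤n seen (suc m) sm≤n with suc m ≤? suc x
  ... | yes sm≤sx = seen (suc m) sm≤sx
  ... | no _ =
    let m≤n                 = ≤-trans (n≤1+n m) sm≤n
        w , w≤x , lm≡lw     = seen-closed x x≤n seen m m≤n
        b , _ , wb , lb≡lsm = zigzag m w (suc m) m≤n (≤-trans w≤x x≤n) sm≤n (sym lm≡lw) (inj₂ (inj₁ refl))
        c , c≤x , lb≡lc     = seen b (≤-trans (near⇒≤suc wb) (s≤s w≤x))
    in c , c≤x , trans (sym lb≡lsm) lb≡lc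

  -- If every label occurs among 0..x, the k+1 labels need k+1 different places,
  -- all of them ≤ h x.
  all-seen⇒k≤h : ∀ x → x ≤ n → Agrees x → (∀ m → m ≤ n → Seen x m) → k ≤ h x
  all-seen⇒k≤h x x≤n agree seen = s≤s⁻¹ (injective⇒≤ {f = slot} slot-injective)
    where
    rep : (j : Fin (suc k)) → Seen x (proj₁ (onto j))
    rep j = seen _ (proj₁ (proj₂ (onto j)))

    rep-label : ∀ j → label (proj₁ (rep j)) ≡ j
    rep-label j = trans (sym (proj₂ (proj₂ (rep j)))) (proj₂ (proj₂ (onto j)))

    slot : Fin (suc k) → Fin (suc (h x))
    slot j = fromℕ< (s≤s (≤-trans (wave≤ _) (h-mono x (proj₁ (proj₂ (rep j))) x≤n)))

    slot-injective : ∀ {i j} → slot i ≡ slot j → i ≡ j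
    slot-injective {i} {j} e = begin
      i                         ≡⟨ rep-label i ⟨
      label (proj₁ (rep i))     ≡⟨ Equivalence.from (agree _ _ (proj₁ (proj₂ (rep i))) (proj₁ (proj₂ (rep j)))) same-place ⟩
      label (proj₁ (rep j))     ≡⟨ rep-label j ⟩
      j                         ∎
      where
      open ≡-Reasoning
      same-place = trans (sym (toℕ-fromℕ< _)) (trans (cong toℕ e) (toℕ-fromℕ< _))

  -- If h x ≥ k, the points 0..x already show the k+1 places 0..k, hence k+1
  -- different labels, which are all the labels there are.
  k≤h⇒all-seen : ∀ x → x ≤ n → Agrees x → k ≤ h x → ∀ s → Seen x s
  k≤h⇒all-seen x x≤n agree k≤h s with seen? x s
  ... | inj₁ seen   = seen
  ... | inj₂ unseen = ⊥-elim (1+n≰n (injective⇒≤ {f = label ∘ witness ∘ toℕ} λ e →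
                        toℕ-injective (distinct _ _ (s≤s⁻¹ (toℕ<n _)) (s≤s⁻¹ (toℕ<n _)) e)))
    where
    witness : ℕ → ℕ
    witness v with v ≤? k
    ... | yes v≤k = proj₁ (placed-below x x≤n k≤h v v≤k)
    ... | no _    = s

    witness-spec : ∀ v → (witness v ≤ x × place (witness v) ≡ v) ⊎ (k < v × witness v ≡ s)
    witness-spec v with v ≤? k
    ... | yes v≤k = inj₁ (proj₂ (placed-below x x≤n k≤h v v≤k))
    ... | no v≰k  = inj₂ (≰⇒> v≰k , refl)

    distinct : ∀ u v → u ≤ suc k → v ≤ suc k → label (witness u) ≡ label (witness v) → u ≡ v
    distinct u v u≤ v≤ e with witness-spec u | witness-spec v
    ... | inj₁ (pu≤x , pu) | inj₁ (pv≤x , pv) =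
      trans (sym pu) (trans (Equivalence.to (agree _ _ pu≤x pv≤x) e) pv)
    ... | inj₁ (pu≤x , _)  | inj₂ (_ , pv≡s)  = ⊥-elim (unseen _ pu≤x (trans (cong label (sym pv≡s)) (sym e)))
    ... | inj₂ (_ , pu≡s)  | inj₁ (pv≤x , _)  = ⊥-elim (unseen _ pv≤x (trans (cong label (sym pu≡s)) e))
    ... | inj₂ (k<u , _)   | inj₂ (k<v , _)   = trans (≤-antisym u≤ k<u) (≤-antisym k<v v≤)

  AgreesAt : ℕ → Set
  AgreesAt x = ∀ y → y ≤ x → (label (suc x) ≡ label y) ⇔ (place (suc x) ≡ place y)

  agrees-extend : ∀ x → Agrees x → AgreesAt x → Agrees (suc x)
  agrees-extend x agree agree-at y y′ y≤ y′≤ with ≤-suc-cases y≤ | ≤-suc-cases y′≤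
  ... | inj₁ y≤x  | inj₁ y′≤x = agree y y′ y≤x y′≤x
  ... | inj₂ refl | inj₁ y′≤x = agree-at y′ y′≤x
  ... | inj₁ y≤x  | inj₂ refl = mk⇔ (λ e → sym (Equivalence.to (agree-at y y≤x) (sym e)))
                                    (λ e → sym (Equivalence.from (agree-at y y≤x) (sym e)))
  ... | inj₂ refl | inj₂ refl = mk⇔ (λ _ → refl) (λ _ → refl)

  agrees-via : ∀ x y₀ → y₀ ≤ x → Agrees x →
               label (suc x) ≡ label y₀ → place (suc x) ≡ place y₀ → AgreesAt x
  agrees-via x y₀ y₀≤x agree same-label same-place y y≤x = mk⇔
    (λ e → trans same-place (Equivalence.to (agree y₀ y y₀≤x y≤x) (trans (sym same-label) e)))
    (λ e → trans same-label (Equivalence.from (agree y₀ y y₀≤x y≤x) (trans (sym same-place) e)))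

  -- If x+1 takes a label already used at y₀, then by the zigzag condition y₀
  -- has a neighbour labelled like x; so the places of x and y₀ are adjacent.
  revisit-adjacent : ∀ x y₀ → suc x ≤ n → Agrees x → label x ≢ label (suc x) →
                     y₀ ≤ x → label (suc x) ≡ label y₀ → Adjacent (place x) (place y₀)
  revisit-adjacent x y₀ sx≤n agree moved y₀≤x revisit =
    near-≢⇒adjacent (near-sym (subst (Near (place y₀)) place-w≡place-x (place-near y₀~w y₀≤n w≤n))) differ
    where
    x≤n = ≤-trans (n≤1+n x) sx≤n
    y₀≤n = ≤-trans y₀≤x x≤n

    differ : place x ≢ place y₀
    differ same = moved (trans (Equivalence.from (agree x y₀ ≤-refl y₀≤x) same) (sym revisit))

    y₀<x : y₀ < x
    y₀<x = ≤∧≢⇒< y₀≤x λ { refl → moved (sym revisit) }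

    back = zigzag (suc x) y₀ x sx≤n y₀≤n x≤n (sym revisit) (inj₂ (inj₂ refl))
    w = proj₁ back
    w≤n = proj₁ (proj₂ back)
    y₀~w = proj₁ (proj₂ (proj₂ back))
    place-w≡place-x : place w ≡ place x
    place-w≡place-x = Equivalence.to (agree w x (≤-trans (near⇒≤suc y₀~w) y₀<x) ≤-refl) (proj₂ (proj₂ (proj₂ back)))

  -- By the zigzag condition some
  -- neighbour of x is labelled like s′; it is not x itself, and it can only be
  -- x − 1 if the wave turns at x.
  forced-successor : ∀ x s s′ → x ≤ n → Agrees x → s ≤ x → s′ ≤ x → Near s s′ →
                     label s ≡ label x → place s′ ≡ wave (suc (h x)) →
                     label (suc x) ≡ label s′ ⊎ (place x ≡ 0 ⊎ place x ≡ k)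
  forced-successor x s s′ x≤n agree s≤x s′≤x s~s′ ls≡lx s′-next
    with zigzag s x s′ (≤-trans s≤x x≤n) x≤n (≤-trans s′≤x x≤n) (sym ls≡lx) s~s′
  ... | w , _ , inj₁ refl , lw≡ls′ =
    ⊥-elim (adjacent⇒≢ (wave-step (h x)) (trans (Equivalence.to (agree x s′ ≤-refl s′≤x) lw≡ls′) s′-next))
  ... | w , _ , inj₂ (inj₁ refl) , lw≡ls′ = inj₁ lw≡ls′
  ... | w , _ , inj₂ (inj₂ refl) , lw≡ls′ with h-step w x≤n
  ...   | inj₁ stay = ⊥-elim (adjacent⇒≢ (wave-step (h x)) (begin
      place (suc w)        ≡⟨ cong wave stay ⟩
      place w              ≡⟨ place-w≡place-s′ ⟩
      place s′             ≡⟨ s′-next ⟩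
      wave (suc (h x))     ∎))
    where
    open ≡-Reasoning
    place-w≡place-s′ = Equivalence.to (agree w s′ (n≤1+n w) s′≤x) lw≡ls′
  ...   | inj₂ move = inj₂ (subst (λ v → wave v ≡ 0 ⊎ wave v ≡ k) (sym move) (wave-turn (h w) (begin
      wave (h w)                   ≡⟨ Equivalence.to (agree w s′ (n≤1+n w) s′≤x) lw≡ls′ ⟩
      place s′                     ≡⟨ s′-next ⟩
      wave (suc (h (suc w)))       ≡⟨ cong (wave ∘ suc) move ⟩
      wave (suc (suc (h w)))       ∎)))
    where open ≡-Reasoning

  -- The places of y₀ and of wave (1 + h x)
  -- are both adjacent to the place of x; were they different they would lie on
  -- either side of it.  Since h x ≥ k, some neighbours t, t′ ≤ x realise the
  -- place of x and the place wave (1 + h x); forced-successor then makes x+1 (and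
  -- hence y₀) sit at wave (1 + h x), unless the wave turns at x, which is
  -- impossible with neighbours on both sides.
  revisit-no-fork : ∀ x y₀ → suc x ≤ n → Agrees x → k ≤ h x → label x ≢ label (suc x) →
                    y₀ ≤ x → label (suc x) ≡ label y₀ → ¬ (place y₀ ≢ wave (suc (h x)))
  revisit-no-fork x y₀ sx≤n agree k≤h moved y₀≤x revisit fork =
    either (opposite-sides (revisit-adjacent x y₀ sx≤n agree moved y₀≤x revisit) (wave-step (h x)) fork)
    where
    x≤n = ≤-trans (n≤1+n x) sx≤n

    conclude : ∀ s′ → s′ ≤ x → place s′ ≡ wave (suc (h x)) →
               label (suc x) ≡ label s′ ⊎ (place x ≡ 0 ⊎ place x ≡ k) →
               place x ≢ 0 → place x ≢ k → ⊥
    conclude s′ s′≤x place-s′ (inj₁ next) _ _ =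
      fork (trans (Equivalence.to (agree y₀ s′ y₀≤x s′≤x) (trans (sym revisit) next)) place-s′)
    conclude _ _ _ (inj₂ (inj₁ at-0)) not-0 _ = not-0 at-0
    conclude _ _ _ (inj₂ (inj₂ at-k)) _ not-k = not-k at-k

    above-k : ∀ {v} → suc k ≡ v → v ≤ k → ⊥
    above-k refl = 1+n≰n

    either : (suc (place x) ≡ place y₀ × place x ≡ suc (wave (suc (h x)))) ⊎
             (place x ≡ suc (place y₀) × suc (place x) ≡ wave (suc (h x))) → ⊥
    -- the wave falls at x and y₀ lies above: cross from place x − 1 up to place x
    either (inj₁ (y₀-above , next-below)) =
      let t , t<x , place-t , place-st = place-crossing x x≤n k≤h _ (subst (_≤ k) next-below (wave≤k (h x)))
          t≤x = ≤-trans (n≤1+n t) t<x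
      in conclude t t≤x place-t
           (forced-successor x (suc t) t x≤n agree t<x t≤x (inj₂ (inj₂ refl))
              (Equivalence.from (agree (suc t) x t<x ≤-refl) (trans place-st (sym next-below))) place-t)
           (λ at-0 → 1+n≢0 (trans (sym next-below) at-0))
           (λ at-k → above-k (trans (cong suc (sym at-k)) y₀-above) (wave≤k (h y₀)))
    -- the wave rises at x and y₀ lies below: cross from place x up to place x + 1
    either (inj₂ (y₀-below , next-above)) =
      let t , t<x , place-t , place-st = place-crossing x x≤n k≤h _ (subst (_≤ k) (sym next-above) (wave≤k (suc (h x))))
          t≤x = ≤-trans (n≤1+n t) t<x
      in conclude (suc t) t<x (trans place-st next-above)
           (forced-successor x t (suc t) x≤n agree t≤x t<x (inj₂ (inj₁ refl))
              (Equivalence.from (agree t x t≤x ≤-refl) place-t) (trans place-st next-above))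
           (λ at-0 → 1+n≢0 (trans (sym y₀-below) at-0))
           (λ at-k → above-k (trans (cong suc (sym at-k)) next-above) (wave≤k (suc (h x))))

  revisit-place : ∀ x y₀ → suc x ≤ n → Agrees x → k ≤ h x → label x ≢ label (suc x) →
                  y₀ ≤ x → label (suc x) ≡ label y₀ → place (suc x) ≡ place y₀
  revisit-place x y₀ sx≤n agree k≤h moved y₀≤x revisit = begin
    place (suc x)      ≡⟨ cong wave (h-move x sx≤n moved) ⟩
    wave (suc (h x))   ≡⟨ decidable-stable (place y₀ ≟ _) (revisit-no-fork x y₀ sx≤n agree k≤h moved y₀≤x revisit) ⟨
    place y₀           ∎
    where open ≡-Reasoning

  -- If x+1 keeps the label of x it keeps its place.  Otherwise
  -- compare h x with k: below k, the label of x+1 must be new (else no label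
  -- would be new from then on, leaving fewer than k+1 labels) and so is its
  -- place; from k on, the label must have been seen (all k+1 labels have), and
  -- revisit-place applies.
  agrees-at : ∀ x → suc x ≤ n → Agrees x → AgreesAt x
  agrees-at x sx≤n agree with label x ≟ᶠ label (suc x)
  ... | yes same = agrees-via x x ≤-refl agree (sym same) (cong wave (h-stay x sx≤n same))
  ... | no moved with seen? x (suc x) | h x <? k
  ...   | inj₁ (y₀ , y₀≤x , revisit) | no h≮k =
    agrees-via x y₀ y₀≤x agree revisit (revisit-place x y₀ sx≤n agree (≮⇒≥ h≮k) moved y₀≤x revisit)
  ...   | inj₁ seen | yes h<k =
    ⊥-elim (<⇒≱ h<k (all-seen⇒k≤h x x≤n agree (seen-closed x x≤n seen-to-x+1)))
    where
    x≤n = ≤-trans (n≤1+n x) sx≤n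
    seen-to-x+1 : ∀ w → w ≤ suc x → Seen x w
    seen-to-x+1 w w≤1+x with ≤-suc-cases w≤1+x
    ... | inj₁ w≤x  = w , w≤x , refl
    ... | inj₂ refl = seen
  ...   | inj₂ unseen | no h≮k =
    let y , y≤x , same = k≤h⇒all-seen x (≤-trans (n≤1+n x) sx≤n) agree (≮⇒≥ h≮k) (suc x)
    in ⊥-elim (unseen y y≤x same)
  ...   | inj₂ unseen | yes h<k = λ y y≤x →
    mk⇔ (λ same → ⊥-elim (unseen y y≤x same)) (λ same → ⊥-elim (1+n≰n (above y y≤x same)))
    where
    -- x+1 lands on the fresh place h x + 1, beyond every place so far.
    above : ∀ y → y ≤ x → place (suc x) ≡ place y → suc (h x) ≤ h x
    above y y≤x same = begin
      suc (h x)       ≡⟨ wave-low h<k ⟨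
      wave (suc (h x)) ≡⟨ cong wave (h-move x sx≤n moved) ⟨
      place (suc x)   ≡⟨ same ⟩
      place y         ≤⟨ wave≤ (h y) ⟩
      h y             ≤⟨ h-mono x y≤x (≤-trans (n≤1+n x) sx≤n) ⟩
      h x             ∎
      where open ≤-Reasoning

  agrees : ∀ x → x ≤ n → Agrees x
  agrees zero    _    y y′ z≤n z≤n = mk⇔ (λ _ → refl) (λ _ → refl)
  agrees (suc x) sx≤n = agrees-extend x agree (agrees-at x sx≤n agree)
    where agree = agrees x (≤-trans (n≤1+n x) sx≤n)

  label≡⇔place≡ : ∀ y y′ → y ≤ n → y′ ≤ n → (label y ≡ label y′) ⇔ (place y ≡ place y′)
  label≡⇔place≡ = agrees n ≤-refl

point : (n m : ℕ) → Pt n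
point n       zero    = fzero
point zero    (suc m) = fzero
point (suc n) (suc m) = fsuc (point n m)

toℕ-point : ∀ {n m} → m ≤ n → toℕ (point n m) ≡ m
toℕ-point {n}     {zero}  _         = refl
toℕ-point {suc n} {suc m} (s≤s m≤n) = cong suc (toℕ-point m≤n)

point-toℕ : ∀ n (x : Pt n) → point n (toℕ x) ≡ x
point-toℕ n       fzero    = refl
point-toℕ (suc n) (fsuc x) = cong fsuc (point-toℕ n x)

toℕ≤n : ∀ {n} (x : Pt n) → toℕ x ≤ n
toℕ≤n x = s≤s⁻¹ (toℕ<n x)

module ClassLabelling {n c : ℕ} {θ : PRel n} (congruence : IsCongruence θ)
                      (f : Pt n → Fin c) (kernel : ∀ x y → θ x y ⇔ (f x ≡ f y)) where

  label : ℕ → Fin c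
  label m = f (point n m)

  label-toℕ : ∀ x → label (toℕ x) ≡ f x
  label-toℕ x = cong f (point-toℕ n x)

  label-kernel : ∀ x y → θ x y ⇔ (label (toℕ x) ≡ label (toℕ y))
  label-kernel x y = mk⇔
    (λ xθy → trans (label-toℕ x) (trans (Equivalence.to (kernel x y) xθy) (sym (label-toℕ y))))
    (λ same → Equivalence.from (kernel x y) (trans (sym (label-toℕ x)) (trans same (label-toℕ y))))

  label-zigzag : ∀ a a′ b → a ≤ n → a′ ≤ n → b ≤ n → label a′ ≡ label a → Near a b →
                 Σ ℕ λ b′ → b′ ≤ n × Near a′ b′ × label b′ ≡ label b
  label-zigzag a a′ b a≤n a′≤n b≤n same a~b =
    let y′ , a′Ry′ , y′θb = IsCongruence.zigzag congruence (point n a) (point n a′) (point n b)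
                              (Equivalence.from (kernel _ _) same) aRb
    in toℕ y′ , toℕ≤n y′ ,
       Equivalence.from (near⇔dist≤1 a′ (toℕ y′)) (subst (λ u → ∣ u - toℕ y′ ∣ ≤ 1) (toℕ-point a′≤n) a′Ry′) ,
       trans (cong f (point-toℕ n y′)) (Equivalence.to (kernel _ _) y′θb)
    where
    aRb : LR (point n a) (point n b)
    aRb = subst₂ (λ u v → ∣ u - v ∣ ≤ 1) (sym (toℕ-point a≤n)) (sym (toℕ-point b≤n))
            (Equivalence.to (near⇔dist≤1 a b) a~b)

  label-onto : (∀ j → Σ (Pt n) λ x → f x ≡ j) → ∀ j → Σ ℕ λ m → m ≤ n × label m ≡ j
  label-onto onto j = let x , fx≡j = onto j in toℕ x , toℕ≤n x , trans (label-toℕ x) fx≡j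

  label-stay⇔∈ : ∀ {rs} → Enumerates θ rs → ∀ m → suc m ≤ n → (label m ≡ label (suc m)) ⇔ (m ∈ rs)
  label-stay⇔∈ {rs} (_ , stays , _) m sm≤n = mk⇔
    (λ same → subst (_∈ rs) m′≡m (Equivalence.to (stays _ _ adjacent) (Equivalence.from (kernel _ _) same)))
    (λ m∈ → Equivalence.to (kernel _ _) (Equivalence.from (stays _ _ adjacent) (subst (_∈ rs) (sym m′≡m) m∈)))
    where
    m′≡m = toℕ-point (≤-trans (n≤1+n m) sm≤n)
    adjacent : toℕ (point n (suc m)) ≡ suc (toℕ (point n m))
    adjacent = trans (toℕ-point sm≤n) (cong suc (sym m′≡m))

lemma2p4 : (n : ℕ) (θ : PRel n) → IsCongruence θ →
    (k : ℕ) → HasClasses θ (suc k) → k ≥ 1 →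
    (rs : List ℕ) → Enumerates θ rs →
    ∀ x y → θ x y ⇔ ⟨ k ⨾ rs ⟩ x y
lemma2p4 n θ congruence zero      _                   ()  rs enumerates x y
lemma2p4 n θ congruence (suc k-1) (f , onto , kernel) _   rs enumerates x y = begin
  θ x y                           ≈⟨ label-kernel x y ⟩
  label (toℕ x) ≡ label (toℕ y)   ≈⟨ label≡⇔place≡ (toℕ x) (toℕ y) (toℕ≤n x) (toℕ≤n y) ⟩
  place (toℕ x) ≡ place (toℕ y)   ≈⟨ wave-≡⇔≡± (reduced rs (toℕ x)) (reduced rs (toℕ y)) ⟩
  ⟨ suc k-1 ⨾ rs ⟩ x y            ∎
  where
  open ClassLabelling congruence f kernel
  open Wave k-1
  increasing : AllPairs _<_ rs
  increasing = Linked⇒AllPairs <-trans (proj₁ enumerates)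
  open LabelledLine n k-1 label label-zigzag (label-onto onto) (reduced rs) (reduced-zero rs)
    (λ m sm≤n same  → reduced-∈ rs m increasing (Equivalence.to (label-stay⇔∈ enumerates m sm≤n) same))
    (λ m sm≤n moved → reduced-∉ rs m increasing (moved ∘ Equivalence.from (label-stay⇔∈ enumerates m sm≤n)))
  open import Relation.Binary.Reasoning.Setoid (⇔-setoid 0ℓ)
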